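{- Let $G$ be a connected $(P_5,K_4,\text{co-banner})$-free graph that has an induced butterfly. Then $cop(G)\leq 2$.
   Context: All graphs are finite, simple and undirected. $P_n$ and $K_n$ denote the path and complete graph on $n$ vertices. The co-banner is the graph on vertices $a,v_1,v_2,v_3,v_4$ with edges $av_1,v_1v_2,v_2v_3,v_3v_4,v_4v_2$. The butterfly is the graph on vertices $b,v_1,v_2,v_3,v_4$ with edges $bv_1,v_1v_2,bv_2,v_2v_3,v_3v_4,v_4v_2$ (two triangles sharing exactly one vertex). A graph is $(H_1,\dots,H_k)$-free if it contains no induced subgraph isomorphic to any $H_i$. Game of cops and robber on a connected graph: first all cops are placed on vertices (several may share a vertex), then the robber chooses a vertex; afterwards cops and robber move alternately, starting with the cops, where a move consists of staying put or moving to an adjacent vertex. The cops win if after finitely many rounds some cop is on the same vertex as the robber. The cop number $cop(G)$ is the minimum number of cops that guarantees a win in each connected component of $G$. -}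

module Defs where

open import Data.Nat using (ℕ; _≤_)
open import Data.Fin using (Fin; zero; suc; _≟_)
open import Data.Bool using (Bool; true; false; _∨_; _∧_)
open import Data.List using (List; []; _∷_)
open import Data.Bool.ListAction using (any)
open import Data.Product using (_×_; _,_; Σ; ∃; ∃-syntax)
open import Data.Sum using (_⊎_)
open import Relation.Nullary using (¬_)
open import Relation.Nullary.Decidable using (⌊_⌋)
open import Relation.Binary.PropositionalEquality using (_≡_)
open import Function.Definitions using (Injective)

record Graph (n : ℕ) : Set where
  field
    Adj   : Fin n → Fin n → Bool
    sym   : ∀ u v → Adj u v ≡ Adj v u
    irrefl : ∀ v → Adj v v ≡ false
open Graph public

Edge : ∀ {n} → Graph n → Fin n → Fin n → Set
Edge G u v = Adj G u v ≡ true

data Reach {n} (G : Graph n) (u : Fin n) : Fin n → Set where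
  here : Reach G u u
  step : ∀ {v w} → Reach G u v → Edge G v w → Reach G u w

Connected : ∀ {n} → Graph n → Set
Connected {n} G = ∀ (u v : Fin n) → Reach G u v

edgeAdj : ∀ {m} → List (Fin m × Fin m) → Fin m → Fin m → Bool
edgeAdj es i j = any (λ { (a , b) → (⌊ a ≟ i ⌋ ∧ ⌊ b ≟ j ⌋) ∨ (⌊ a ≟ j ⌋ ∧ ⌊ b ≟ i ⌋) }) es

HasInduced : ∀ {m n} → (Fin m → Fin m → Bool) → Graph n → Set
HasInduced {m} {n} H G =
  Σ (Fin m → Fin n) λ f → Injective _≡_ _≡_ f × (∀ i j → Adj G (f i) (f j) ≡ H i j)

Free : ∀ {m n} → (Fin m → Fin m → Bool) → Graph n → Set
Free H G = ¬ HasInduced H G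

private
  v0 v1 v2 v3 v4 : Fin 5
  v0 = zero
  v1 = suc zero
  v2 = suc (suc zero)
  v3 = suc (suc (suc zero))
  v4 = suc (suc (suc (suc zero)))

  w0 w1 w2 w3 : Fin 4
  w0 = zero
  w1 = suc zero
  w2 = suc (suc zero)
  w3 = suc (suc (suc zero))

P5 : Fin 5 → Fin 5 → Bool
P5 = edgeAdj ((v0 , v1) ∷ (v1 , v2) ∷ (v2 , v3) ∷ (v3 , v4) ∷ [])

K4 : Fin 4 → Fin 4 → Bool
K4 = edgeAdj ((w0 , w1) ∷ (w0 , w2) ∷ (w0 , w3) ∷ (w1 , w2) ∷ (w1 , w3) ∷ (w2 , w3) ∷ [])

CoBanner : Fin 5 → Fin 5 → Bool
CoBanner = edgeAdj ((v0 , v1) ∷ (v1 , v2) ∷ (v2 , v3) ∷ (v3 , v4) ∷ (v4 , v2) ∷ [])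

Butterfly : Fin 5 → Fin 5 → Bool
Butterfly = edgeAdj ((v0 , v1) ∷ (v1 , v2) ∷ (v0 , v2) ∷ (v2 , v3) ∷ (v3 , v4) ∷ (v4 , v2) ∷ [])

Move : ∀ {n} → Graph n → Fin n → Fin n → Set
Move G x y = (y ≡ x) ⊎ Edge G x y

CopsMove : ∀ {n k} → Graph n → (Fin k → Fin n) → (Fin k → Fin n) → Set
CopsMove {k = k} G c c' = ∀ (i : Fin k) → Move G (c i) (c' i)

Caught : ∀ {n k} → (Fin k → Fin n) → Fin n → Set
Caught {k = k} c r = ∃[ i ] c i ≡ r

-- CopsForce G c r : cops at c, robber at r, cops to move, and the cops can
-- force a capture within finitely many rounds (inductive = well-founded).
data CopsForce {n k} (G : Graph n) : (Fin k → Fin n) → Fin n → Set where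
  caught : ∀ {c r} → Caught c r → CopsForce G c r
  round  : ∀ {c r} (c' : Fin k → Fin n) → CopsMove G c c' →
           (Caught c' r ⊎ (∀ r' → Move G r r' → CopsForce G c' r')) →
           CopsForce G c r

CopsWin : ∀ {n} → ℕ → Graph n → Set
CopsWin {n} k G = Σ (Fin k → Fin n) λ c → ∀ (r : Fin n) → CopsForce G c r

CopNumber≤ : ∀ {n} → Graph n → ℕ → Set
CopNumber≤ G m = ∃[ k ] (k ≤ m × CopsWin k G)

module Submission where

-- Split the butterfly into its centre c and its wings a₁a₂, b₁b₂, which induce
-- a 2K₂, and call a vertex full when it is adjacent to all four wing vertices.
-- Freeness of P₅ and co-banner is only used through one fact: if p–q–r is an
-- induced path and p, q have no neighbour on an edge uv, neither has r.
-- Freeness of K₄ only makes full vertices pairwise non-adjacent.  With these,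
-- every vertex is adjacent to a₁ or to a full vertex.  Scanning the vertices and
-- switching the current full vertex to a full neighbour of a vertex that neither
-- it nor a₁ dominates loses no earlier vertex, so a₁ and one full vertex z
-- dominate G.  Cops placed on a₁ and z catch the robber in their first move.

open import Defs
open import Data.Nat using (ℕ; z≤n; s≤s)
open import Data.Bool using (Bool; true; false)
import Data.Bool.Properties as Bool
open import Data.Fin using (Fin; zero; suc; Fin′; inject; compare; less; equal; greater; #_)
open import Data.Fin.Properties using (all?) renaming (_≟_ to _≟ᶠ_)
open import Data.Vec using ([]; _∷_; lookup)
open import Data.List using ([]; _∷_; allFin)
open import Data.List.Relation.Unary.All as All using (All; []; _∷_)
open import Data.List.Membership.Propositional.Properties using (∈-allFin)
open import Data.Product using (_×_; _,_; proj₁; proj₂; Σ-syntax; ∃-syntax; swap)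
open import Data.Sum using (_⊎_; inj₁; inj₂; [_,_]′)
open import Data.Empty using (⊥-elim)
open import Function using (_∘_)
open import Relation.Nullary using (¬_; Dec)
open import Relation.Nullary.Decidable using (from-yes; _×-dec_; _→-dec_)
open import Relation.Binary.PropositionalEquality as ≡ using (_≡_; refl; trans; cong)

-- Twin-freeness forces every adjacency-preserving map out of the pattern to be injective.
IsSimplePattern : ∀ {m} → (Fin m → Fin m → Bool) → Set
IsSimplePattern H =
  (∀ i j → H i j ≡ H j i) × (∀ i → H i i ≡ false) × (∀ i j → (∀ k → H i k ≡ H j k) → i ≡ j)

isSimplePattern? : ∀ {m} (H : Fin m → Fin m → Bool) → Dec (IsSimplePattern H)
isSimplePattern? H =
  all? (λ i → all? λ j → H i j Bool.≟ H j i) ×-dec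
  all? (λ i → H i i Bool.≟ false) ×-dec
  all? (λ i → all? λ j → all? (λ k → H i k Bool.≟ H j k) →-dec i ≟ᶠ j)

module Adjacency {n : ℕ} (G : Graph n) where

  infix 4 _~_ _≁_

  _~_ : Fin n → Fin n → Set
  u ~ v = Edge G u v

  _≁_ : Fin n → Fin n → Set
  u ≁ v = Adj G u v ≡ false

  adj-sym : ∀ {u v b} → Adj G u v ≡ b → Adj G v u ≡ b
  adj-sym {u} {v} uv = trans (Graph.sym G v u) uv

  adjacent? : ∀ u v → u ~ v ⊎ u ≁ v
  adjacent? u v with Adj G u v
  ... | true  = inj₁ refl
  ... | false = inj₂ refl

  ≁⇒¬~ : ∀ {u v} → u ≁ v → ¬ u ~ v
  ≁⇒¬~ u≁v u~v with () ← trans (≡.sym u~v) u≁v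

  Dominates : Fin n → Fin n → Set
  Dominates u x = u ≡ x ⊎ u ~ x

  Meets Misses Complete : Fin n → Fin n → Fin n → Set
  Meets x u v = x ~ u ⊎ x ~ v
  Misses x u v = x ≁ u × x ≁ v
  Complete x u v = x ~ u × x ~ v

  misses⇒¬meets : ∀ {x u v} → Misses x u v → ¬ Meets x u v
  misses⇒¬meets (x≁u , _) (inj₁ x~u) = ≁⇒¬~ x≁u x~u
  misses⇒¬meets (_ , x≁v) (inj₂ x~v) = ≁⇒¬~ x≁v x~v

  ¬misses⇒meets : ∀ {x u v} → ¬ Misses x u v → Meets x u v
  ¬misses⇒meets {x} {u} {v} ¬misses with adjacent? x u | adjacent? x v
  ... | inj₁ x~u | _        = inj₁ x~u
  ... | inj₂ _   | inj₁ x~v = inj₂ x~v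
  ... | inj₂ x≁u | inj₂ x≁v = ⊥-elim (¬misses (x≁u , x≁v))

  ¬meets⇒misses : ∀ {x u v} → ¬ Meets x u v → Misses x u v
  ¬meets⇒misses {x} {u} {v} ¬meets with adjacent? x u | adjacent? x v
  ... | inj₂ x≁u | inj₂ x≁v = x≁u , x≁v
  ... | inj₁ x~u | _        = ⊥-elim (¬meets (inj₁ x~u))
  ... | _        | inj₁ x~v = ⊥-elim (¬meets (inj₂ x~v))

  record Induced2K2 (a₁ a₂ b₁ b₂ : Fin n) : Set where
    field
      a-edge    : a₁ ~ a₂
      b-edge    : b₁ ~ b₂
      a₁-misses : Misses a₁ b₁ b₂
      a₂-misses : Misses a₂ b₁ b₂

  swap-a : ∀ {a₁ a₂ b₁ b₂} → Induced2K2 a₁ a₂ b₁ b₂ → Induced2K2 a₂ a₁ b₁ b₂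
  swap-a W = record
    { a-edge = adj-sym a-edge ; b-edge = b-edge ; a₁-misses = a₂-misses ; a₂-misses = a₁-misses }
    where open Induced2K2 W

  flip : ∀ {a₁ a₂ b₁ b₂} → Induced2K2 a₁ a₂ b₁ b₂ → Induced2K2 b₁ b₂ a₁ a₂
  flip W = record
    { a-edge    = b-edge
    ; b-edge    = a-edge
    ; a₁-misses = adj-sym (proj₁ a₁-misses) , adj-sym (proj₁ a₂-misses)
    ; a₂-misses = adj-sym (proj₂ a₁-misses) , adj-sym (proj₂ a₂-misses)
    }
    where open Induced2K2 W

  induced-from-upper : ∀ {m} {H : Fin m → Fin m → Bool} → IsSimplePattern H → (u : Fin m → Fin n) →
    (∀ j (i : Fin′ j) → Adj G (u (inject i)) (u j) ≡ H (inject i) j) → HasInduced H G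
  induced-from-upper {H = H} (H-sym , H-irrefl , H-twin-free) u upper = u , injective , agree
    where
    agree : ∀ i j → Adj G (u i) (u j) ≡ H i j
    agree i j with compare i j
    ... | less j i′    = upper j i′
    ... | equal i      = trans (Graph.irrefl G (u i)) (≡.sym (H-irrefl i))
    ... | greater i j′ = trans (adj-sym (upper i j′)) (H-sym (inject j′) i)

    injective : ∀ {i j} → u i ≡ u j → i ≡ j
    injective {i} {j} uᵢ≡uⱼ = H-twin-free i j λ k →
      trans (≡.sym (agree i k)) (trans (cong (λ v → Adj G v (u k)) uᵢ≡uⱼ) (agree j k))

  induced-P5 : ∀ {u₀ u₁ u₂ u₃ u₄} → u₀ ~ u₁ → u₁ ~ u₂ → u₂ ~ u₃ → u₃ ~ u₄ →
    u₀ ≁ u₂ → u₀ ≁ u₃ → u₀ ≁ u₄ → u₁ ≁ u₃ → u₁ ≁ u₄ → u₂ ≁ u₄ → HasInduced P5 G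
  induced-P5 {u₀} {u₁} {u₂} {u₃} {u₄} e₀₁ e₁₂ e₂₃ e₃₄ n₀₂ n₀₃ n₀₄ n₁₃ n₁₄ n₂₄ =
    induced-from-upper (from-yes (isSimplePattern? P5)) (lookup (u₀ ∷ u₁ ∷ u₂ ∷ u₃ ∷ u₄ ∷ [])) λ where
      zero ()
      (suc zero) zero → e₀₁
      (suc (suc zero)) zero → n₀₂
      (suc (suc zero)) (suc zero) → e₁₂
      (suc (suc (suc zero))) zero → n₀₃
      (suc (suc (suc zero))) (suc zero) → n₁₃
      (suc (suc (suc zero))) (suc (suc zero)) → e₂₃
      (suc (suc (suc (suc zero)))) zero → n₀₄
      (suc (suc (suc (suc zero)))) (suc zero) → n₁₄
      (suc (suc (suc (suc zero)))) (suc (suc zero)) → n₂₄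
      (suc (suc (suc (suc zero)))) (suc (suc (suc zero))) → e₃₄

  induced-CoBanner : ∀ {u₀ u₁ u₂ u₃ u₄} → u₀ ~ u₁ → u₁ ~ u₂ → u₂ ~ u₃ → u₃ ~ u₄ → u₂ ~ u₄ →
    u₀ ≁ u₂ → u₀ ≁ u₃ → u₀ ≁ u₄ → u₁ ≁ u₃ → u₁ ≁ u₄ → HasInduced CoBanner G
  induced-CoBanner {u₀} {u₁} {u₂} {u₃} {u₄} e₀₁ e₁₂ e₂₃ e₃₄ e₂₄ n₀₂ n₀₃ n₀₄ n₁₃ n₁₄ =
    induced-from-upper (from-yes (isSimplePattern? CoBanner)) (lookup (u₀ ∷ u₁ ∷ u₂ ∷ u₃ ∷ u₄ ∷ [])) λ where
      zero ()
      (suc zero) zero → e₀₁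
      (suc (suc zero)) zero → n₀₂
      (suc (suc zero)) (suc zero) → e₁₂
      (suc (suc (suc zero))) zero → n₀₃
      (suc (suc (suc zero))) (suc zero) → n₁₃
      (suc (suc (suc zero))) (suc (suc zero)) → e₂₃
      (suc (suc (suc (suc zero)))) zero → n₀₄
      (suc (suc (suc (suc zero)))) (suc zero) → n₁₄
      (suc (suc (suc (suc zero)))) (suc (suc zero)) → e₂₄
      (suc (suc (suc (suc zero)))) (suc (suc (suc zero))) → e₃₄

  induced-K4 : ∀ {u₀ u₁ u₂ u₃} → u₀ ~ u₁ → u₀ ~ u₂ → u₀ ~ u₃ → u₁ ~ u₂ → u₁ ~ u₃ → u₂ ~ u₃ →
    HasInduced K4 G
  induced-K4 {u₀} {u₁} {u₂} {u₃} e₀₁ e₀₂ e₀₃ e₁₂ e₁₃ e₂₃ =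
    induced-from-upper (from-yes (isSimplePattern? K4)) (lookup (u₀ ∷ u₁ ∷ u₂ ∷ u₃ ∷ [])) λ where
      zero ()
      (suc zero) zero → e₀₁
      (suc (suc zero)) zero → e₀₂
      (suc (suc zero)) (suc zero) → e₁₂
      (suc (suc (suc zero))) zero → e₀₃
      (suc (suc (suc zero))) (suc zero) → e₁₃
      (suc (suc (suc zero))) (suc (suc zero)) → e₂₃

  step-towards : Fin n → Fin n → Fin n
  step-towards r u with Adj G u r
  ... | true  = r
  ... | false = u

  step-towards-moves : ∀ r u → Move G u (step-towards r u)
  step-towards-moves r u with Adj G u r in eq
  ... | true  = inj₂ eq
  ... | false = inj₁ refl

  step-towards-arrives : ∀ {r u} → u ~ r → step-towards r u ≡ r
  step-towards-arrives u~r rewrite u~r = refl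

  dominating-set-wins : ∀ {k} (c : Fin k → Fin n) → (∀ x → ∃[ i ] Dominates (c i) x) → CopsWin k G
  dominating-set-wins c dominates = c , λ r → capture r (dominates r)
    where
    capture : ∀ r → ∃[ i ] Dominates (c i) r → CopsForce G c r
    capture r (i , inj₁ cᵢ≡r) = caught (i , cᵢ≡r)
    capture r (i , inj₂ cᵢ~r) =
      round (λ j → step-towards r (c j)) (λ j → step-towards-moves r (c j))
        (inj₁ (i , step-towards-arrives cᵢ~r))

  dominating-pair-wins : ∀ {u v} → (∀ x → Dominates u x ⊎ Dominates v x) → CopsWin 2 G
  dominating-pair-wins {u} {v} dominates =
    dominating-set-wins (lookup (u ∷ v ∷ [])) λ x → [ (zero ,_) , (suc zero ,_) ]′ (dominates x)

module ForbiddenSubgraphs {n : ℕ} (G : Graph n)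
  (P5-free : Free P5 G) (K4-free : Free K4 G) (coBanner-free : Free CoBanner G) where

  open Adjacency G

  end-of-P₃-misses-vertex : ∀ {p q r u v} → p ~ q → q ~ r → p ≁ r →
    Misses p u v → Misses q u v → u ~ v → r ≁ u
  end-of-P₃-misses-vertex {r = r} {u} {v} pq qr p≁r (p≁u , p≁v) (q≁u , q≁v) uv
    with adjacent? r u | adjacent? r v
  ... | inj₂ r≁u | _ = r≁u
  ... | inj₁ ru | inj₁ rv =
    ⊥-elim (coBanner-free (induced-CoBanner pq qr ru uv rv p≁r p≁u p≁v q≁u q≁v))
  ... | inj₁ ru | inj₂ r≁v =
    ⊥-elim (P5-free (induced-P5 pq qr ru uv p≁r p≁u p≁v q≁u q≁v r≁v))

  end-of-P₃-misses-edge : ∀ {p q r u v} → p ~ q → q ~ r → p ≁ r →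
    Misses p u v → Misses q u v → u ~ v → Misses r u v
  end-of-P₃-misses-edge pq qr p≁r p-misses q-misses uv =
    end-of-P₃-misses-vertex pq qr p≁r p-misses q-misses uv ,
    end-of-P₃-misses-vertex pq qr p≁r (swap p-misses) (swap q-misses) (adj-sym uv)

  common-neighbours-nonadjacent : ∀ {u v x y} → u ~ v → Complete x u v → Complete y u v → x ≁ y
  common-neighbours-nonadjacent {x = x} {y} uv (xu , xv) (yu , yv) with adjacent? x y
  ... | inj₂ x≁y = x≁y
  ... | inj₁ xy  =
    ⊥-elim (K4-free (induced-K4 uv (adj-sym xu) (adj-sym yu) (adj-sym xv) (adj-sym yv) xy))

  meets-b-and-a₁⇒a₂ : ∀ {a₁ a₂ b₁ b₂ y} → Induced2K2 a₁ a₂ b₁ b₂ → y ~ a₁ → Meets y b₁ b₂ → y ~ a₂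
  meets-b-and-a₁⇒a₂ {a₂ = a₂} {b₁} {b₂} {y} W ya₁ y-meets-b with adjacent? y a₂
  ... | inj₁ ya₂  = ya₂
  ... | inj₂ y≁a₂ = ⊥-elim (misses⇒¬meets y-misses-b y-meets-b)
    where
    open Induced2K2 W
    y-misses-b : Misses y b₁ b₂
    y-misses-b =
      end-of-P₃-misses-edge (adj-sym a-edge) (adj-sym ya₁) (adj-sym y≁a₂) a₂-misses a₁-misses b-edge

  meets-both⇒complete-a : ∀ {a₁ a₂ b₁ b₂ y} → Induced2K2 a₁ a₂ b₁ b₂ →
    Meets y a₁ a₂ → Meets y b₁ b₂ → Complete y a₁ a₂
  meets-both⇒complete-a W (inj₁ ya₁) y-meets-b = ya₁ , meets-b-and-a₁⇒a₂ W ya₁ y-meets-b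
  meets-both⇒complete-a W (inj₂ ya₂) y-meets-b = meets-b-and-a₁⇒a₂ (swap-a W) ya₂ y-meets-b , ya₂

  meets-both⇒complete : ∀ {a₁ a₂ b₁ b₂ y} → Induced2K2 a₁ a₂ b₁ b₂ →
    Meets y a₁ a₂ → Meets y b₁ b₂ → Complete y a₁ a₂ × Complete y b₁ b₂
  meets-both⇒complete W y-meets-a y-meets-b =
    meets-both⇒complete-a W y-meets-a y-meets-b , meets-both⇒complete-a (flip W) y-meets-b y-meets-a

  neighbour-meets-a : ∀ {a₁ a₂ b₁ b₂ x y z} → Induced2K2 a₁ a₂ b₁ b₂ →
    Complete z a₁ a₂ → Complete z b₁ b₂ → z ~ y → y ~ x → z ≁ x →
    ¬ (Complete x a₁ a₂ × Complete x b₁ b₂) → Meets y a₁ a₂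
  neighbour-meets-a {a₁} {a₂} {b₁} {b₂} {x} {y} {z} W (za₁ , _) (zb₁ , _) zy yx z≁x x-not-full =
    ¬misses⇒meets λ y-misses-a → misses⇒¬meets (y-misses-b y-misses-a) (y-meets-b y-misses-a)
    where
    open Induced2K2 W

    via-y : ∀ {u v} → Misses x u v → Misses y u v → u ~ v → Misses z u v
    via-y = end-of-P₃-misses-edge (adj-sym yx) (adj-sym zy) (adj-sym z≁x)

    x-meets-a : Misses y a₁ a₂ → Meets x a₁ a₂
    x-meets-a y-misses-a = ¬misses⇒meets λ x-misses-a →
      misses⇒¬meets (via-y x-misses-a y-misses-a a-edge) (inj₁ za₁)

    x-misses-b : Misses y a₁ a₂ → Misses x b₁ b₂
    x-misses-b y-misses-a = ¬meets⇒misses λ x-meets-b →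
      x-not-full (meets-both⇒complete W (x-meets-a y-misses-a) x-meets-b)

    y-meets-b : Misses y a₁ a₂ → Meets y b₁ b₂
    y-meets-b y-misses-a = ¬misses⇒meets λ y-misses-b →
      misses⇒¬meets (via-y (x-misses-b y-misses-a) y-misses-b b-edge) (inj₁ zb₁)

    y-misses-b : Misses y a₁ a₂ → Misses y b₁ b₂
    y-misses-b y-misses-a with x-meets-a y-misses-a
    ... | inj₁ xa₁ = end-of-P₃-misses-edge (adj-sym xa₁) (adj-sym yx) (adj-sym (proj₁ y-misses-a))
                       a₁-misses (x-misses-b y-misses-a) b-edge
    ... | inj₂ xa₂ = end-of-P₃-misses-edge (adj-sym xa₂) (adj-sym yx) (adj-sym (proj₂ y-misses-a))
                       a₂-misses (x-misses-b y-misses-a) b-edge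

  module Wings {a₁ a₂ b₁ b₂ : Fin n} (W : Induced2K2 a₁ a₂ b₁ b₂) where

    open Induced2K2 W

    Full : Fin n → Set
    Full z = Complete z a₁ a₂ × Complete z b₁ b₂

    full-~a₁ : ∀ {z} → Full z → z ~ a₁
    full-~a₁ = proj₁ ∘ proj₁

    a₁≁⇒¬full : ∀ {x} → a₁ ≁ x → ¬ Full x
    a₁≁⇒¬full a₁≁x ((xa₁ , _) , _) = ≁⇒¬~ a₁≁x (adj-sym xa₁)

    full-nonadjacent : ∀ {z z′} → Full z → Full z′ → z ≁ z′
    full-nonadjacent (za , _) (z′a , _) = common-neighbours-nonadjacent a-edge za z′a

    full-middle : ∀ {x y z} → Full z → z ~ y → y ~ x → z ≁ x → ¬ Full x → Full y
    full-middle (za , zb) zy yx z≁x x-not-full = meets-both⇒complete W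
      (neighbour-meets-a W za zb zy yx z≁x x-not-full)
      (neighbour-meets-a (flip W) zb za zy yx z≁x (x-not-full ∘ swap))

    module Centred {c : Fin n} (c-full : Full c) where

      Dominated : Fin n → Set
      Dominated x = a₁ ~ x ⊎ Σ[ z ∈ Fin n ] Full z × z ~ x

      a₁-neighbour-full : ∀ {y} → c ≁ y → a₁ ~ y → Full y
      a₁-neighbour-full {y} c≁y a₁y =
        meets-both⇒complete W (inj₁ (adj-sym a₁y)) (¬misses⇒meets λ y-misses-b →
          misses⇒¬meets (c-misses-b y-misses-b) (inj₁ (proj₁ (proj₂ c-full))))
        where
        c-misses-b : Misses y b₁ b₂ → Misses c b₁ b₂
        c-misses-b y-misses-b = end-of-P₃-misses-edge (adj-sym a₁y) (adj-sym (full-~a₁ c-full)) (adj-sym c≁y)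
          y-misses-b a₁-misses b-edge

      a₁-adjacent : ∀ {x y z} → c ≁ y → Full z → z ~ y → y ~ x → a₁ ≁ x → c ≁ x → z ≁ x → a₁ ~ y
      a₁-adjacent {x} {y} {z} c≁y z-full zy yx a₁≁x c≁x z≁x with adjacent? a₁ y
      ... | inj₁ a₁y  = a₁y
      ... | inj₂ a₁≁y = ⊥-elim (≁⇒¬~ (proj₁ z-misses-yx) zy)
        where
        z-misses-yx : Misses z y x
        z-misses-yx = end-of-P₃-misses-edge (full-~a₁ c-full) (adj-sym (full-~a₁ z-full))
          (full-nonadjacent c-full z-full) (c≁y , c≁x) (a₁≁y , a₁≁x) yx

      neighbour-full : ∀ {x y} → y ~ x → a₁ ≁ x → c ≁ x → (c ≁ y → a₁ ~ y) → Full y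
      neighbour-full {y = y} yx a₁≁x c≁x a₁y with adjacent? c y
      ... | inj₁ cy  = full-middle c-full cy yx c≁x (a₁≁⇒¬full a₁≁x)
      ... | inj₂ c≁y = a₁-neighbour-full c≁y (a₁y c≁y)

      dominated-step : ∀ {x y} → Dominated y → y ~ x → Dominated x
      dominated-step {x} {y} y-dominated yx with adjacent? a₁ x | adjacent? c x
      ... | inj₁ a₁x  | _        = inj₁ a₁x
      ... | inj₂ _    | inj₁ cx  = inj₂ (c , c-full , cx)
      ... | inj₂ a₁≁x | inj₂ c≁x with y-dominated
      ...   | inj₁ a₁y = inj₂ (y , neighbour-full yx a₁≁x c≁x (λ _ → a₁y) , yx)
      ...   | inj₂ (z , z-full , zy) with adjacent? z x
      ...     | inj₁ zx  = inj₂ (z , z-full , zx)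
      ...     | inj₂ z≁x = inj₂ (y , neighbour-full yx a₁≁x c≁x
                                      (λ c≁y → a₁-adjacent c≁y z-full zy yx a₁≁x c≁x z≁x) , yx)

      all-dominated : Connected G → ∀ x → Dominated x
      all-dominated connected x = along (connected c x)
        where
        along : ∀ {x} → Reach G c x → Dominated x
        along here       = inj₁ (adj-sym (full-~a₁ c-full))
        along (step r e) = dominated-step (along r) e

      full-neighbour-shift : ∀ {w x z z′} → Full z → Full z′ → z ~ x → a₁ ≁ x →
        z ≁ w → a₁ ≁ w → z′ ~ w → z′ ~ x
      full-neighbour-shift {w} {x} {z′ = z′} z-full z′-full zx a₁≁x z≁w a₁≁w z′w with adjacent? z′ x
      ... | inj₁ z′x  = z′x
      ... | inj₂ z′≁x = ⊥-elim (a₁≁⇒¬full a₁≁w (full-middle z′-full z′w wx z′≁x (a₁≁⇒¬full a₁≁x)))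
        where
        wx : w ~ x
        wx with adjacent? w x
        ... | inj₁ wx  = wx
        ... | inj₂ w≁x = ⊥-elim (≁⇒¬~ (proj₁ a₁-misses-z′w) (adj-sym (full-~a₁ z′-full)))
          where
          a₁-misses-z′w : Misses a₁ z′ w
          a₁-misses-z′w = end-of-P₃-misses-edge (adj-sym zx) (full-~a₁ z-full) (adj-sym a₁≁x)
            (adj-sym z′≁x , adj-sym w≁x) (full-nonadjacent z-full z′-full , z≁w) z′w

      Covered : Fin n → Fin n → Set
      Covered z x = Dominates a₁ x ⊎ Dominates z x

      covered-shift : ∀ {w x z z′} → Full z → Full z′ → z ≁ w → a₁ ≁ w → z′ ~ w →
        Covered z x → Covered z′ x
      covered-shift _ _ _ _ _ (inj₁ a₁-dominates) = inj₁ a₁-dominates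
      covered-shift ((za₁ , _) , _) _ _ _ _ (inj₂ (inj₁ refl)) = inj₁ (inj₂ (adj-sym za₁))
      covered-shift {x = x} z-full z′-full z≁w a₁≁w z′w (inj₂ (inj₂ zx)) with adjacent? a₁ x
      ... | inj₁ a₁x  = inj₁ (inj₂ a₁x)
      ... | inj₂ a₁≁x = inj₂ (inj₂ (full-neighbour-shift z-full z′-full zx a₁≁x z≁w a₁≁w z′w))

      covering-full-vertex : Connected G → ∀ l → Σ[ z ∈ Fin n ] Full z × All (Covered z) l
      covering-full-vertex connected [] = c , c-full , []
      covering-full-vertex connected (w ∷ l) with covering-full-vertex connected l
      ... | z , z-full , covered with adjacent? a₁ w | adjacent? z w | all-dominated connected w
      ...   | inj₁ a₁w  | _        | _        = z , z-full , inj₁ (inj₂ a₁w) ∷ covered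
      ...   | inj₂ _    | inj₁ zw  | _        = z , z-full , inj₂ (inj₂ zw) ∷ covered
      ...   | inj₂ a₁≁w | inj₂ _   | inj₁ a₁w = ⊥-elim (≁⇒¬~ a₁≁w a₁w)
      ...   | inj₂ a₁≁w | inj₂ z≁w | inj₂ (z′ , z′-full , z′w) =
        z′ , z′-full , inj₂ (inj₂ z′w) ∷ All.map (covered-shift z-full z′-full z≁w a₁≁w z′w) covered

      dominating-pair : Connected G → Σ[ z ∈ Fin n ] ∀ x → Covered z x
      dominating-pair connected with covering-full-vertex connected (allFin n)
      ... | z , _ , covered = z , λ x → All.lookup covered (∈-allFin x)

lemma3p5 : ∀ {n : ℕ} (G : Graph n) → Connected G →
    Free P5 G → Free K4 G → Free CoBanner G → HasInduced Butterfly G →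
    CopNumber≤ G 2
lemma3p5 G connected P5-free K4-free coBanner-free (f , _ , adj) =
  2 , s≤s (s≤s z≤n) , dominating-pair-wins (proj₂ (dominating-pair connected))
  where
  open Adjacency G
  open ForbiddenSubgraphs G P5-free K4-free coBanner-free

  wings : Induced2K2 (f (# 0)) (f (# 1)) (f (# 3)) (f (# 4))
  wings = record
    { a-edge    = adj (# 0) (# 1)
    ; b-edge    = adj (# 3) (# 4)
    ; a₁-misses = adj (# 0) (# 3) , adj (# 0) (# 4)
    ; a₂-misses = adj (# 1) (# 3) , adj (# 1) (# 4)
    }

  open Wings wings

  centre-full : Full (f (# 2))
  centre-full = (adj (# 2) (# 0) , adj (# 2) (# 1)) , (adj (# 2) (# 3) , adj (# 2) (# 4))

  open Centred centre-full
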